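{- In the edge-distinguishing game (EDGe) played on the cycle $C_7$ (with $\lambda(C_7)$ colors), Player 2 has a winning strategy.
   Context: $C_n$ is the cycle on $n$ vertices. For a positive integer $k$ let $[k]=\{1,\dots,k\}$. A $k$-coloring $c:V(G)\to[k]$ induces $c'(\{u,v\})=\{c(u),c(v)\}$ (a multiset); $c$ is edge-distinguishing if $c'$ is injective, and $\lambda(G)$ is the least $k$ admitting such a coloring. A partial coloring on $U\subseteq V(G)$ has partial induced edge coloring on $G[U]$. EDGe on $G$: two players, Player 1 first, alternately color an uncolored vertex with a color from $[\lambda(G)]$; a move is legal iff afterwards the partial induced edge coloring of the colored vertices is injective. The player making the last legal move wins. A winning strategy guarantees a win regardless of the opponent's play. -}

module Defs where

open import Data.Nat using (ℕ; suc; _≤_)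
open import Data.Nat.DivMod using (_mod_)
open import Data.Fin using (Fin; toℕ; _≟_)
open import Data.Maybe using (Maybe; just; nothing)
open import Data.Product using (Σ; ∃; _×_; _,_; proj₁; proj₂)
open import Data.Sum using (_⊎_)
open import Relation.Nullary using (yes; no)
open import Relation.Binary.PropositionalEquality using (_≡_)

record Graph : Set where
  field
    nV   : ℕ
    nE   : ℕ
    ends : Fin nE → Fin nV × Fin nV
open Graph public

-- The cycle C_(suc m) on vertices 0..m, edges {i, i+1 mod (suc m)}.
-- (For suc m ≥ 3 these edges are pairwise distinct, so edge indices = edges.)
Cycle : ℕ → Graph
Cycle m = record
  { nV = suc m ; nE = suc m
  ; ends = λ i → i , (suc (toℕ i) mod suc m) }

-- C_n for n = suc m
C : ℕ → Graph
C 0 = Cycle 0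
C (suc m) = Cycle m

SameMultiset : {A : Set} → A → A → A → A → Set
SameMultiset a b a' b' = (a ≡ a' × b ≡ b') ⊎ (a ≡ b' × b ≡ a')

Coloring : Graph → ℕ → Set
Coloring G k = Fin (nV G) → Fin k

EdgeDistinguishing : (G : Graph) {k : ℕ} → Coloring G k → Set
EdgeDistinguishing G c =
  ∀ e e' →
  SameMultiset (c (proj₁ (ends G e))) (c (proj₂ (ends G e)))
               (c (proj₁ (ends G e'))) (c (proj₂ (ends G e'))) →
  e ≡ e'

IsLambda : Graph → ℕ → Set
IsLambda G k =
  (Σ (Coloring G k) (EdgeDistinguishing G)) ×
  (∀ j → Σ (Coloring G j) (EdgeDistinguishing G) → k ≤ j)

PartialColoring : Graph → ℕ → Set
PartialColoring G k = Fin (nV G) → Maybe (Fin k)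

PartialEdgeDistinguishing : (G : Graph) {k : ℕ} → PartialColoring G k → Set
PartialEdgeDistinguishing G p =
  ∀ e e' a b a' b' →
  p (proj₁ (ends G e)) ≡ just a → p (proj₂ (ends G e)) ≡ just b →
  p (proj₁ (ends G e')) ≡ just a' → p (proj₂ (ends G e')) ≡ just b' →
  SameMultiset a b a' b' → e ≡ e'

update : (G : Graph) {k : ℕ} → PartialColoring G k → Fin (nV G) → Fin k →
         PartialColoring G k
update G p v x w with w ≟ v
... | yes _ = just x
... | no  _ = p w

LegalMove : (G : Graph) (k : ℕ) → PartialColoring G k → Set
LegalMove G k p =
  Σ (Fin (nV G)) λ v → Σ (Fin k) λ x →
    (p v ≡ nothing) × PartialEdgeDistinguishing G (update G p v x)

play : (G : Graph) (k : ℕ) (p : PartialColoring G k) → LegalMove G k p →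
       PartialColoring G k
play G k p (v , x , _) = update G p v x

-- Normal play (last legal move wins). Since every move colors a new vertex,
-- the game is finite and these inductive predicates express existence of a
-- winning strategy for the player to move (ToMoveWins) resp. for the other
-- player (ToMoveLoses).
mutual
  data ToMoveWins (G : Graph) (k : ℕ) (p : PartialColoring G k) : Set where
    win : (m : LegalMove G k p) → ToMoveLoses G k (play G k p m) →
          ToMoveWins G k p

  data ToMoveLoses (G : Graph) (k : ℕ) (p : PartialColoring G k) : Set where
    lose : ((m : LegalMove G k p) → ToMoveWins G k (play G k p m)) →
           ToMoveLoses G k p

emptyColoring : (G : Graph) (k : ℕ) → PartialColoring G k
emptyColoring G k _ = nothing

Player2Wins : Graph → ℕ → Set
Player2Wins G k = ToMoveLoses G k (emptyColoring G k)

{-# OPTIONS --safe #-}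
module Submission where

-- Seven edges need seven distinct color multisets, and three colors offer only six, so
-- λ(C₇) ≥ 4; coloring the vertices 0,0,1,1,2,2,3 around the cycle distinguishes all edges,
-- so λ(C₇) = 4.  With four colors the game on C₇ is small enough to be solved outright:
-- a boolean game-tree search, proved sound for every graph, confirms that Player 1 loses.

open import Defs
open import Data.Bool using (Bool; true; false; T; not; _∧_; _∨_)
open import Data.Bool.ListAction using (all; any)
open import Data.Bool.Properties using (T-∧)
open import Data.Empty using (⊥; ⊥-elim)
open import Data.Fin using (Fin; zero; suc; inject≤; _≟_)
open import Data.Fin.Properties using (all?; pigeonhole; <⇒≢; inject≤-injective)
open import Data.List using (allFin)
import Data.List.Relation.Unary.All as All
open import Data.List.Relation.Unary.All.Properties using (all⁺; all⁻)
import Data.List.Relation.Unary.Any as Any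
open import Data.List.Relation.Unary.Any.Properties using (any⁻)
open import Data.List.Membership.Propositional.Properties using (∈-allFin)
open import Data.Maybe using (Maybe; just; nothing)
import Data.Maybe.Properties as Maybe
open import Data.Nat using (ℕ; zero; suc; _<_; s≤s)
open import Data.Nat.Properties using (≤-refl; ≤-antisym; ≰⇒>; _≤?_)
open import Data.Product using (Σ; ∃; _×_; _,_; proj₁; proj₂)
open import Data.Sum as Sum using (_⊎_; inj₁; inj₂; [_,_])
open import Data.Vec using (Vec; lookup; replicate; _∷_; []; _[_]≔_)
open import Data.Vec.Properties using (lookup∘update; lookup∘update′; lookup-replicate)
open import Function using (_⇔_; mk⇔; Equivalence; _∘_; id)
open import Function.Definitions using (Injective)
open import Relation.Binary.Definitions using (DecidableEquality)
open import Relation.Binary.PropositionalEquality using (_≡_; refl; sym; trans; subst; _≗_)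
open import Relation.Nullary using (Dec; yes; no; ¬_; contradiction)
open import Relation.Nullary.Decidable
  using (_×-dec_; _⊎-dec_; _→-dec_; ¬?; T?; isYes; map′; toSum; toWitness; fromWitness; from-yes)

sameMultiset? : {A : Set} → DecidableEquality A → (a b a' b' : A) → Dec (SameMultiset a b a' b')
sameMultiset? _≟_ a b a' b' = (a ≟ a' ×-dec b ≟ b') ⊎-dec (a ≟ b' ×-dec b ≟ a')

sameMultiset-map⁻ : {A B : Set} {f : A → B} → Injective _≡_ _≡_ f →
  ∀ {a b a' b'} → SameMultiset (f a) (f b) (f a') (f b') → SameMultiset a b a' b'
sameMultiset-map⁻ f-inj (inj₁ (p , q)) = inj₁ (f-inj p , f-inj q)
sameMultiset-map⁻ f-inj (inj₂ (p , q)) = inj₂ (f-inj p , f-inj q)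

edgeDistinguishing? : (G : Graph) {k : ℕ} (c : Coloring G k) → Dec (EdgeDistinguishing G c)
edgeDistinguishing? G c = all? λ e → all? λ e' →
  sameMultiset? _≟_ (c (proj₁ (ends G e))) (c (proj₂ (ends G e)))
                    (c (proj₁ (ends G e'))) (c (proj₂ (ends G e'))) →-dec e ≟ e'

edgeDistinguishing-∘ : (G : Graph) {j k : ℕ} {f : Fin k → Fin j} → Injective _≡_ _≡_ f →
  (c : Coloring G k) → EdgeDistinguishing G c → EdgeDistinguishing G (f ∘ c)
edgeDistinguishing-∘ G f-inj c c-ed e e' = c-ed e e' ∘ sameMultiset-map⁻ f-inj

edgeDistinguishing-pigeonhole : (G : Graph) {k m : ℕ} (code : Fin k → Fin k → Fin m) →
  (∀ {a b a' b'} → code a b ≡ code a' b' → SameMultiset a b a' b') →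
  m < nE G → (c : Coloring G k) → ¬ EdgeDistinguishing G c
edgeDistinguishing-pigeonhole G code code-inj m<nE c c-ed
  with pigeonhole m<nE (λ e → code (c (proj₁ (ends G e))) (c (proj₂ (ends G e))))
... | e , e' , e<e' , same = <⇒≢ e<e' (c-ed e e' (code-inj same))

unorderedPairCode₃ : Fin 3 → Fin 3 → Fin 6
unorderedPairCode₃ zero             zero             = zero
unorderedPairCode₃ zero             (suc zero)       = suc zero
unorderedPairCode₃ zero             (suc (suc zero)) = suc (suc zero)
unorderedPairCode₃ (suc zero)       zero             = suc zero
unorderedPairCode₃ (suc zero)       (suc zero)       = suc (suc (suc zero))
unorderedPairCode₃ (suc zero)       (suc (suc zero)) = suc (suc (suc (suc zero)))
unorderedPairCode₃ (suc (suc zero)) zero             = suc (suc zero)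
unorderedPairCode₃ (suc (suc zero)) (suc zero)       = suc (suc (suc (suc zero)))
unorderedPairCode₃ (suc (suc zero)) (suc (suc zero)) = suc (suc (suc (suc (suc zero))))

unorderedPairCode₃-injective : ∀ {a b a' b'} →
  unorderedPairCode₃ a b ≡ unorderedPairCode₃ a' b' → SameMultiset a b a' b'
unorderedPairCode₃-injective {a} {b} {a'} {b'} = from-yes
  (all? λ a → all? λ b → all? λ a' → all? λ b' →
    unorderedPairCode₃ a b ≟ unorderedPairCode₃ a' b' →-dec sameMultiset? _≟_ a b a' b')
  a b a' b'

C₇-<4⇒¬edgeDistinguishing : {k : ℕ} → k < 4 →
  (c : Coloring (C 7) k) → ¬ EdgeDistinguishing (C 7) c
C₇-<4⇒¬edgeDistinguishing (s≤s k≤3) c c-ed =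
  edgeDistinguishing-pigeonhole (C 7) unorderedPairCode₃ unorderedPairCode₃-injective ≤-refl
    (λ v → inject≤ (c v) k≤3)
    (edgeDistinguishing-∘ (C 7) (inject≤-injective k≤3 k≤3 _ _) c c-ed)

C₇-edgeDistinguishing₄ : Σ (Coloring (C 7) 4) (EdgeDistinguishing (C 7))
C₇-edgeDistinguishing₄ = c , from-yes (edgeDistinguishing? (C 7) c)
  where
  c : Coloring (C 7) 4
  c = lookup (zero ∷ zero ∷ suc zero ∷ suc zero ∷
              suc (suc zero) ∷ suc (suc zero) ∷ suc (suc (suc zero)) ∷ [])

C₇-λ≡4 : {k : ℕ} → IsLambda (C 7) k → k ≡ 4
C₇-λ≡4 {k} ((c , c-ed) , minimal) with 4 ≤? k
... | yes 4≤k = ≤-antisym (minimal 4 C₇-edgeDistinguishing₄) 4≤k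
... | no 4≰k = ⊥-elim (C₇-<4⇒¬edgeDistinguishing (≰⇒> 4≰k) c c-ed)

T-implication : ∀ {b c} → T b → T (not b ∨ c) → T c
T-implication {true} _ h = h

T-all-allFin : {n : ℕ} {p : Fin n → Bool} → T (all p (allFin n)) ⇔ (∀ i → T (p i))
T-all-allFin {n} {p} = mk⇔ (λ h i → All.lookup (all⁺ p (allFin n) h) (∈-allFin i))
                           (λ h → all⁻ p {allFin n} (All.tabulate λ {i} _ → h i))

T-any-allFin⁻ : {n : ℕ} (p : Fin n → Bool) → T (any p (allFin n)) → ∃ (T ∘ p)
T-any-allFin⁻ {n} p h = Any.satisfied (any⁻ p (allFin n) h)

-- Unlike Data.Fin.Properties.all?, this decides by a plain boolean fold, which keeps the
-- exhaustive game search below fast enough to run during type checking.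
all?ᵇ : {n : ℕ} {P : Fin n → Set} → (∀ i → Dec (P i)) → Dec (∀ i → P i)
all?ᵇ P? = map′ (λ h i → toWitness {a? = P? i} (Equivalence.to T-all-allFin h i))
                (λ h → Equivalence.from T-all-allFin (λ i → fromWitness {a? = P? i} (h i)))
                (T? (all (isYes ∘ P?) (allFin _)))

Clash : {A : Set} → Maybe A → Maybe A → Maybe A → Maybe A → Set
Clash (just a) (just b) (just a') (just b') = SameMultiset a b a' b'
Clash _ _ _ _ = ⊥

clash? : {A : Set} → DecidableEquality A → (ma mb ma' mb' : Maybe A) → Dec (Clash ma mb ma' mb')
clash? _≟_ (just a) (just b) (just a') (just b') = sameMultiset? _≟_ a b a' b'
clash? _ nothing _ _ _ = no λ ()
clash? _ (just _) nothing _ _ = no λ ()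
clash? _ (just _) (just _) nothing _ = no λ ()
clash? _ (just _) (just _) (just _) nothing = no λ ()

clash-intro : {A : Set} {ma mb ma' mb' : Maybe A} {a b a' b' : A} →
  ma ≡ just a → mb ≡ just b → ma' ≡ just a' → mb' ≡ just b' →
  SameMultiset a b a' b' → Clash ma mb ma' mb'
clash-intro refl refl refl refl s = s

clash-elim : {A R : Set} {ma mb ma' mb' : Maybe A} →
  (∀ {a b a' b'} → ma ≡ just a → mb ≡ just b → ma' ≡ just a' → mb' ≡ just b' →
                   SameMultiset a b a' b' → R) →
  Clash ma mb ma' mb' → R
clash-elim {ma = just _} {just _} {just _} {just _} r s = r refl refl refl refl s

module _ (G : Graph) {k : ℕ} where

  ClashFree : PartialColoring G k → Set
  ClashFree p = ∀ e e' → e ≡ e' ⊎ ¬ Clash (p (proj₁ (ends G e))) (p (proj₂ (ends G e)))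
                                          (p (proj₁ (ends G e'))) (p (proj₂ (ends G e')))

  partialEdgeDistinguishing⇔clashFree : (p : PartialColoring G k) →
    PartialEdgeDistinguishing G p ⇔ ClashFree p
  partialEdgeDistinguishing⇔clashFree p = mk⇔
    (λ ped e e' → Sum.map₂ (λ e≢e' → e≢e' ∘ clash-elim (ped e e' _ _ _ _)) (toSum (e ≟ e')))
    (λ free e e' a b a' b' pa pb pa' pb' s →
       [ id , contradiction (clash-intro pa pb pa' pb' s) ] (free e e'))

  partialEdgeDistinguishing? : (p : PartialColoring G k) → Dec (PartialEdgeDistinguishing G p)
  partialEdgeDistinguishing? p = map′ (Equivalence.from ⇔) (Equivalence.to ⇔)
    (all?ᵇ λ e → all?ᵇ λ e' →
      e ≟ e' ⊎-dec ¬? (clash? _≟_ (p (proj₁ (ends G e))) (p (proj₂ (ends G e)))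
                                  (p (proj₁ (ends G e'))) (p (proj₂ (ends G e')))))
    where ⇔ = partialEdgeDistinguishing⇔clashFree p

  partialEdgeDistinguishing-≗ : {p q : PartialColoring G k} → p ≗ q →
    PartialEdgeDistinguishing G p → PartialEdgeDistinguishing G q
  partialEdgeDistinguishing-≗ p≗q ped e e' a b a' b' pa pb pa' pb' =
    ped e e' a b a' b' (trans (p≗q _) pa) (trans (p≗q _) pb)
                       (trans (p≗q _) pa') (trans (p≗q _) pb')

  update-≗ : {p q : PartialColoring G k} → p ≗ q → ∀ v x → update G p v x ≗ update G q v x
  update-≗ p≗q v x w with w ≟ v
  ... | yes _ = refl
  ... | no _ = p≗q w

  legalMove-≗ : {p q : PartialColoring G k} → p ≗ q → LegalMove G k p → LegalMove G k q
  legalMove-≗ p≗q (v , x , free , ped) =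
    v , x , trans (sym (p≗q v)) free , partialEdgeDistinguishing-≗ (update-≗ p≗q v x) ped

  mutual
    toMoveWins-≗ : {p q : PartialColoring G k} → p ≗ q → ToMoveWins G k p → ToMoveWins G k q
    toMoveWins-≗ p≗q (win m@(v , x , _) l) =
      win (legalMove-≗ p≗q m) (toMoveLoses-≗ (update-≗ p≗q v x) l)

    toMoveLoses-≗ : {p q : PartialColoring G k} → p ≗ q → ToMoveLoses G k p → ToMoveLoses G k q
    toMoveLoses-≗ p≗q (lose f) = lose λ m@(v , x , _) →
      toMoveWins-≗ (update-≗ p≗q v x) (f (legalMove-≗ (sym ∘ p≗q) m))

  Position : Set
  Position = Vec (Maybe (Fin k)) (nV G)

  color : Position → Fin (nV G) → Fin k → Position
  color s v x = s [ v ]≔ just x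

  update∘lookup : (s : Position) (v : Fin (nV G)) (x : Fin k) →
    update G (lookup s) v x ≗ lookup (color s v x)
  update∘lookup s v x w with w ≟ v
  ... | yes refl = sym (lookup∘update w s (just x))
  ... | no w≢v = sym (lookup∘update′ w≢v s (just x))

  Legal : Position → Fin (nV G) → Fin k → Set
  Legal s v x = lookup s v ≡ nothing × PartialEdgeDistinguishing G (lookup (color s v x))

  legal? : (s : Position) (v : Fin (nV G)) (x : Fin k) → Dec (Legal s v x)
  legal? s v x =
    Maybe.≡-dec _≟_ (lookup s v) nothing ×-dec partialEdgeDistinguishing? (lookup (color s v x))

  legal⇒legalMove : (s : Position) {v : Fin (nV G)} {x : Fin k} →
    Legal s v x → LegalMove G k (lookup s)
  legal⇒legalMove s {v} {x} (free , ped) =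
    v , x , free , partialEdgeDistinguishing-≗ (sym ∘ update∘lookup s v x) ped

  legalMove⇒legal : (s : Position) ((v , x , _) : LegalMove G k (lookup s)) → Legal s v x
  legalMove⇒legal s (v , x , free , ped) =
    free , partialEdgeDistinguishing-≗ (update∘lookup s v x) ped

  winsᵇ losesᵇ : ℕ → Position → Bool
  losesᵇ n s = all (λ v → all (λ x →
    not (isYes (legal? s v x)) ∨ winsᵇ n (color s v x)) (allFin _)) (allFin _)
  winsᵇ zero    _ = false
  winsᵇ (suc n) s = any (λ v → any (λ x →
    isYes (legal? s v x) ∧ losesᵇ n (color s v x)) (allFin _)) (allFin _)

  mutual
    losesᵇ-sound : ∀ n s → T (losesᵇ n s) → ToMoveLoses G k (lookup s)
    losesᵇ-sound n s h = lose λ m@(v , x , _) →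
      toMoveWins-≗ (sym ∘ update∘lookup s v x)
        (winsᵇ-sound n (color s v x)
          (T-implication (fromWitness {a? = legal? s v x} (legalMove⇒legal s m))
                         (Equivalence.to T-all-allFin (Equivalence.to T-all-allFin h v) x)))

    winsᵇ-sound : ∀ n s → T (winsᵇ n s) → ToMoveWins G k (lookup s)
    winsᵇ-sound (suc n) s h with T-any-allFin⁻ _ h
    ... | v , h′ with T-any-allFin⁻ _ h′
    ... | x , h″ with Equivalence.to T-∧ h″
    ... | legal , l =
      win (legal⇒legalMove s (toWitness {a? = legal? s v x} legal))
          (toMoveLoses-≗ (sym ∘ update∘lookup s v x) (losesᵇ-sound n _ l))

  player2Wins-by-search : T (losesᵇ (nV G) (replicate (nV G) nothing)) → Player2Wins G k
  player2Wins-by-search h =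
    toMoveLoses-≗ (λ v → lookup-replicate v nothing)
                  (losesᵇ-sound (nV G) (replicate (nV G) nothing) h)

-- The hole is filled by evaluating the search to true; an explicit tt would make Agda run it twice.
C₇-player2Wins₄ : Player2Wins (C 7) 4
C₇-player2Wins₄ = player2Wins-by-search (C 7) _

theorem3p16 : (k : ℕ) → IsLambda (C 7) k → Player2Wins (C 7) k
theorem3p16 k isλ = subst (Player2Wins (C 7)) (sym (C₇-λ≡4 isλ)) C₇-player2Wins₄
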